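{- If $K_n$ is the complete graph of order $n\ge 3$, then $mag^-(K_n)=n-1$.
   Context: For an oriented graph $\vec G$, two distinct vertices $x,y$ monitor an arc $a$ if $a$ lies on every shortest directed path from $x$ to $y$, or on every shortest directed path from $y$ to $x$. A monitoring arc-geodetic set (MAG-set) is a vertex set $M$ such that every arc is monitored by some pair of distinct vertices of $M$; $mag(\vec G)$ is the minimum size of an MAG-set. For an undirected graph $G$, $mag^-(G)$ is the minimum of $mag(\vec G)$ over all orientations $\vec G$ of $G$. -}

module Defs where

open import Data.Nat using (ℕ; zero; suc; _≤_)
open import Data.Fin using (Fin)
open import Data.Fin.Subset using (Subset; _∈_; ∣_∣)
open import Data.Bool using (Bool; true; false)
open import Data.List using (List; []; _∷_)
open import Data.List.Relation.Unary.Unique.Propositional using (Unique)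
open import Data.Product using (Σ; ∃; _×_; _,_)
open import Data.Sum using (_⊎_)
open import Relation.Binary.PropositionalEquality using (_≡_; _≢_)

-- An orientation of the complete graph K_n on vertex set Fin n, i.e. a
-- tournament: for every pair of distinct vertices exactly one of the two
-- arcs is present, and there are no loops.
record Tournament (n : ℕ) : Set where
  field
    arc     : Fin n → Fin n → Bool
    noLoop  : ∀ i → arc i i ≡ false
    oneWay  : ∀ i j → i ≢ j → (arc i j ≡ true × arc j i ≡ false)
                            ⊎ (arc i j ≡ false × arc j i ≡ true)
open Tournament public

module _ {n : ℕ} (T : Tournament n) where

  data Walk : Fin n → Fin n → Set where
    [] : ∀ {x} → Walk x x
    _∷_ : ∀ {x y z} → arc T x y ≡ true → Walk y z → Walk x z

  len : ∀ {x y} → Walk x y → ℕ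
  len [] = zero
  len (_ ∷ p) = suc (len p)

  verts : ∀ {x y} → Walk x y → List (Fin n)
  verts {x} [] = x ∷ []
  verts {x} (_ ∷ p) = x ∷ verts p

  IsPath : ∀ {x y} → Walk x y → Set
  IsPath p = Unique (verts p)

  IsShortest : ∀ {x y} → Walk x y → Set
  IsShortest {x} {y} p = IsPath p × (∀ (q : Walk x y) → IsPath q → len p ≤ len q)

  data ArcOn (u v : Fin n) : ∀ {x y} → Walk x y → Set where
    here  : ∀ {z} (e : arc T u v ≡ true) (p : Walk v z) → ArcOn u v {u} {z} (e ∷ p)
    there : ∀ {x y z} (e : arc T x y ≡ true) {p : Walk y z} → ArcOn u v p → ArcOn u v (e ∷ p)

  OnAllShortest : Fin n → Fin n → Fin n → Fin n → Set
  OnAllShortest x y u v =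
    (Σ (Walk x y) IsShortest) × (∀ (p : Walk x y) → IsShortest p → ArcOn u v p)

  Monitors : Fin n → Fin n → Fin n → Fin n → Set
  Monitors x y u v = OnAllShortest x y u v ⊎ OnAllShortest y x u v

  IsMAG : Subset n → Set
  IsMAG M = ∀ u v → arc T u v ≡ true →
    ∃ λ x → ∃ λ y → x ∈ M × y ∈ M × x ≢ y × Monitors x y u v

-- mag^-(K_n) = k : some orientation of K_n has an MAG-set of size k, and
-- every MAG-set of every orientation of K_n has size at least k.
MagMinusKIs : ℕ → ℕ → Set
MagMinusKIs n k =
  (Σ (Tournament n) λ T → Σ (Subset n) λ M → IsMAG T M × ∣ M ∣ ≡ k)
  × (∀ (T : Tournament n) (M : Subset n) → IsMAG T M → k ≤ ∣ M ∣)

-- Upper bound: add vertices 0 and 1 to any tournament on the remaining vertices i ≥ 2,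
-- with arcs 0 → 1 → i → 0.  The unique geodesic from i to 1 is i → 0 → 1, so every arc
-- at 0 is monitored by two vertices of M = V ∖ {0}, and every other arc by its own ends.
--
-- Lower bound: suppose an arc u → v joins two vertices outside an MAG-set M, and orient each
-- monitoring geodesic towards its end in M.  The one through u → v continues v → w₀; shortness
-- gives w₀ → u, and since every geodesic of its pair uses u → v, no z ≠ v has u → z → w₀, so
-- w₀ beats every out-neighbour of u except v.  Hence the geodesic through wₖ → u continues
-- u → v → wₖ₊₁, and shortness gives wₖ₊₁ → wₖ and N⁺(wₖ) ⊆ N⁺(wₖ₊₁).  So each wⱼ beats every
-- earlier wᵢ, which is impossible for n + 1 terms in a tournament on n vertices.
module Submission where

open import Data.Bool using (Bool; true; false)
open import Data.Empty using (⊥; ⊥-elim)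
open import Data.Fin using (Fin; zero; suc; toℕ; _≟_)
open import Data.Fin.Properties using (pigeonhole; suc-injective)
open import Data.Fin.Subset using (Subset; inside; outside; _∈_; _∉_; ∣_∣; ⊤)
open import Data.Fin.Subset.Properties using (∈⊤; ∣⊤∣≡n; drop-there)
open import Data.List.Membership.Propositional using () renaming (_∈_ to _∈ₗ_)
open import Data.List.Relation.Unary.All using ([]; _∷_)
open import Data.List.Relation.Unary.All.Properties using (¬Any⇒All¬; All¬⇒¬Any)
open import Data.List.Relation.Unary.AllPairs using ([]; _∷_)
open import Data.List.Relation.Unary.Any using (here; there)
open import Data.Nat using (ℕ; zero; suc; _+_; _≤_; _<_; _∸_; z≤n; s≤s; _≤?_)
open import Data.Nat.Properties
  using ( ≤-refl; ≤-trans; <⇒≤; ≤-reflexive; m≤n⇒m≤1+n; <⇒≱; ≰⇒>; n<1+n; m<1+n⇒m<n∨m≡n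
        ; +-cancelˡ-≤; +-cancelʳ-≤)
open import Data.Product using (Σ; ∃; ∃₂; _×_; _,_; proj₁; proj₂)
open import Data.Sum using (_⊎_; inj₁; inj₂; [_,_]′)
import Data.Sum as Sum
open import Data.Vec using (_∷_; here; there)
open import Function using (_∘_; _∘₂_; id)
open import Relation.Nullary using (¬_; yes; no; contradiction)
open import Relation.Binary.PropositionalEquality using (_≡_; _≢_; refl; sym; trans; cong; subst; subst₂)

open import Defs

no-dominating-chain : ∀ {n} (R : Fin n → Fin n → Set) {P : Fin n → Set} → (∀ {i} → ¬ R i i) →
  ∃ P → (∀ {w} → P w → ∃ λ c → P c × R c w × (∀ {z} → R w z → R c z)) → ⊥
no-dominating-chain {n} R {P} R-irrefl start next =
  let i , j , i<j , wᵢ≡wⱼ = pigeonhole (n<1+n n) (w ∘ toℕ)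
  in R-irrefl (subst (λ t → R t (w (toℕ i))) (sym wᵢ≡wⱼ) (later-dominates i<j))
  where
    chain : ℕ → ∃ P
    chain zero = start
    chain (suc k) = let c , Pc , _ = next (proj₂ (chain k)) in c , Pc

    w : ℕ → Fin n
    w k = proj₁ (chain k)

    step : ∀ k → R (w (suc k)) (w k) × (∀ {z} → R (w k) z → R (w (suc k)) z)
    step k = proj₂ (proj₂ (next (proj₂ (chain k))))

    later-dominates : ∀ {i j} → i < j → R (w j) (w i)
    later-dominates {i} {suc j} i<1+j with m<1+n⇒m<n∨m≡n i<1+j
    ... | inj₁ i<j = proj₂ (step j) (later-dominates i<j)
    ... | inj₂ refl = proj₁ (step i)

Arc : ∀ {n} → Tournament n → Fin n → Fin n → Set
Arc T i j = arc T i j ≡ true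

module Walks {n : ℕ} (T : Tournament n) where

  open import Data.List.Membership.DecPropositional (_≟_ {n}) using (_∈?_)
  open import Data.List.Relation.Unary.Unique.DecPropositional (_≟_ {n}) using (unique?)

  ¬arc : ∀ {i j} → arc T i j ≡ false → ¬ Arc T i j
  ¬arc ¬ij ij = contradiction (trans (sym ij) ¬ij) λ ()

  arc-irreflexive : ∀ {i} → ¬ Arc T i i
  arc-irreflexive {i} = ¬arc (noLoop T i)

  arc-total : ∀ {i j} → i ≢ j → Arc T i j ⊎ Arc T j i
  arc-total i≢j = Sum.map proj₁ proj₂ (oneWay T _ _ i≢j)

  arc-asymmetric : ∀ {i j} → Arc T i j → ¬ Arc T j i
  arc-asymmetric {i} {j} ij ji with oneWay T i j (λ { refl → arc-irreflexive ij })
  ... | inj₁ (_ , ¬ji) = ¬arc ¬ji ji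
  ... | inj₂ (¬ij , _) = ¬arc ¬ij ij

  ¬reverse⇒arc : ∀ {i j} → i ≢ j → ¬ Arc T j i → Arc T i j
  ¬reverse⇒arc i≢j ¬ji = [ id , (λ ji → contradiction ji ¬ji) ]′ (arc-total i≢j)

  infixr 5 _++_
  _++_ : ∀ {x a y} → Walk T x a → Walk T a y → Walk T x y
  [] ++ q = q
  (e ∷ p) ++ q = e ∷ (p ++ q)

  len-++ : ∀ {x a y} (p : Walk T x a) (q : Walk T a y) → len T (p ++ q) ≡ len T p + len T q
  len-++ [] q = refl
  len-++ (e ∷ p) q = cong suc (len-++ p q)

  junction∈verts : ∀ {x a y} (p : Walk T x a) (q : Walk T a y) → a ∈ₗ verts T (p ++ q)
  junction∈verts [] [] = here refl
  junction∈verts [] (e ∷ q) = here refl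
  junction∈verts (e ∷ p) q = there (junction∈verts p q)

  arcOn⇒source∈verts : ∀ {u v x y} {p : Walk T x y} → ArcOn T u v p → u ∈ₗ verts T p
  arcOn⇒source∈verts (here _ _) = here refl
  arcOn⇒source∈verts (there _ uv∈p) = there (arcOn⇒source∈verts uv∈p)

  arcOn-split : ∀ {u v x y} {p : Walk T x y} → ArcOn T u v p →
    ∃₂ λ (A : Walk T x u) (uv : Arc T u v) → ∃ λ (B : Walk T v y) → p ≡ A ++ uv ∷ B
  arcOn-split (here uv B) = [] , uv , B , refl
  arcOn-split (there e uv∈p) =
    let A , uv , B , p≡ = arcOn-split uv∈p in e ∷ A , uv , B , cong (e ∷_) p≡

  suffixFrom : ∀ {z x y} (p : Walk T x y) → z ∈ₗ verts T p →
    Σ (Walk T z y) λ q → len T q ≤ len T p × (IsPath T p → IsPath T q)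
  suffixFrom [] (here refl) = [] , ≤-refl , id
  suffixFrom (e ∷ p) (here refl) = e ∷ p , ≤-refl , id
  suffixFrom (e ∷ p) (there z∈p) =
    let q , q≤p , q-path = suffixFrom p z∈p
    in q , m≤n⇒m≤1+n q≤p , λ { (_ ∷ p-path) → q-path p-path }

  toPath : ∀ {x y} (p : Walk T x y) → Σ (Walk T x y) λ q → IsPath T q × len T q ≤ len T p
  toPath [] = [] , [] ∷ [] , ≤-refl
  toPath {x} (e ∷ p) with q , q-path , q≤p ← toPath p | x ∈? verts T q
  ... | yes x∈q = let r , r≤q , r-path = suffixFrom q x∈q
                  in r , r-path q-path , m≤n⇒m≤1+n (≤-trans r≤q q≤p)
  ... | no x∉q = e ∷ q , ¬Any⇒All¬ _ x∉q ∷ q-path , s≤s q≤p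

  shortcut : ∀ {x y} (p : Walk T x y) → ¬ IsPath T p → Σ (Walk T x y) λ q → len T q < len T p
  shortcut [] ¬path = contradiction ([] ∷ []) ¬path
  shortcut {x} (e ∷ p) ¬path with x ∈? verts T p
  ... | yes x∈p = let q , q≤p , _ = suffixFrom p x∈p in q , s≤s q≤p
  ... | no x∉p = let q , q<p = shortcut p (¬path ∘ (¬Any⇒All¬ _ x∉p ∷_)) in e ∷ q , s≤s q<p

  shortest⇒minimal : ∀ {x y} {p : Walk T x y} → IsShortest T p → (q : Walk T x y) → len T p ≤ len T q
  shortest⇒minimal (_ , p-min) q = let r , r-path , r≤q = toPath q in ≤-trans (p-min r r-path) r≤q

  no-longer⇒shortest : ∀ {x y} {p q : Walk T x y} → IsShortest T p → len T q ≤ len T p → IsShortest T q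
  no-longer⇒shortest {q = q} p-short q≤p with unique? (verts T q)
  ... | yes q-path = q-path , λ r r-path → ≤-trans q≤p (proj₂ p-short r r-path)
  ... | no ¬q-path = let r , r<q = shortcut q ¬q-path
                     in contradiction (≤-trans q≤p (shortest⇒minimal p-short r)) (<⇒≱ r<q)

  shortest-segment-minimal : ∀ {x a b y} (A : Walk T x a) (m : Walk T a b) (C : Walk T b y) →
    IsShortest T (A ++ m ++ C) → (m′ : Walk T a b) → len T m ≤ len T m′
  shortest-segment-minimal A m C short m′ =
    +-cancelʳ-≤ (len T C) _ _ (+-cancelˡ-≤ (len T A) _ _
      (subst₂ _≤_ (len-++₃ m) (len-++₃ m′) (shortest⇒minimal short (A ++ m′ ++ C))))
    where
      len-++₃ : ∀ m → len T (A ++ m ++ C) ≡ len T A + (len T m + len T C)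
      len-++₃ m = trans (len-++ A (m ++ C)) (cong (len T A +_) (len-++ m C))

  shortest⇒back-arc : ∀ {x a b y} (A : Walk T x a) (m : Walk T a b) (C : Walk T b y) →
    IsShortest T (A ++ m ++ C) → 2 ≤ len T m → Arc T b a
  shortest⇒back-arc {a = a} {b} A m C short 2≤m = ¬reverse⇒arc b≢a ¬ab
    where
      b≢a : b ≢ a
      b≢a refl = contradiction (≤-trans 2≤m (shortest-segment-minimal A m C short [])) λ ()
      ¬ab : ¬ Arc T a b
      ¬ab ab = contradiction (≤-trans 2≤m (shortest-segment-minimal A m C short (ab ∷ [])))
                             λ { (s≤s ()) }

  shortest⇒out-dominated : ∀ {x a b y} (A : Walk T x a) (m : Walk T a b) (C : Walk T b y) →
    IsShortest T (A ++ m ++ C) → 3 ≤ len T m → ∀ {z} → Arc T a z → Arc T b z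
  shortest⇒out-dominated {b = b} A m C short 3≤m {z} az = ¬reverse⇒arc b≢z ¬zb
    where
      b≢z : b ≢ z
      b≢z refl = arc-asymmetric (shortest⇒back-arc A m C short (<⇒≤ 3≤m)) az
      ¬zb : ¬ Arc T z b
      ¬zb zb = contradiction (≤-trans 3≤m (shortest-segment-minimal A m C short (az ∷ zb ∷ [])))
                             λ { (s≤s (s≤s ())) }

  path-arcOn⇒target : ∀ {x u v z y} (A : Walk T x u) (uz : Arc T u z) (B : Walk T z y) →
    IsPath T (A ++ uz ∷ B) → ArcOn T u v (A ++ uz ∷ B) → v ≡ z
  path-arcOn⇒target [] uz B _ (here _ _) = refl
  path-arcOn⇒target [] uz B (u∉B ∷ _) (there _ uv∈B) =
    contradiction (arcOn⇒source∈verts uv∈B) (All¬⇒¬Any u∉B)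
  path-arcOn⇒target (_ ∷ A) uz B (u∉rest ∷ _) (here _ _) =
    contradiction (junction∈verts A (uz ∷ B)) (All¬⇒¬Any u∉rest)
  path-arcOn⇒target (_ ∷ A) uz B (_ ∷ path) (there _ uv∈rest) = path-arcOn⇒target A uz B path uv∈rest

  -- Rerouting through u → z → b keeps the length, hence gives another geodesic, which must
  -- also leave u along u → v.
  geodesic-middle-unique : ∀ {x u v b y z} (A : Walk T x u) (uv : Arc T u v) (vb : Arc T v b)
    (C : Walk T b y) →
    IsShortest T (A ++ uv ∷ vb ∷ C) → (∀ q → IsShortest T q → ArcOn T u v q) →
    Arc T u z → Arc T z b → v ≡ z
  geodesic-middle-unique A ab vb C short through uz zb =
    path-arcOn⇒target A uz (zb ∷ C) (proj₁ detour-short) (through _ detour-short)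
    where
      detour-short : IsShortest T (A ++ uz ∷ zb ∷ C)
      detour-short = no-longer⇒shortest short (≤-reflexive (trans (len-++ A _) (sym (len-++ A _))))

  arc-onAllShortest : ∀ {u v} (uv : Arc T u v) → OnAllShortest T u v u v
  arc-onAllShortest {u} {v} uv = (uv ∷ [] , path , minimal) , through
    where
      u≢v : u ≢ v
      u≢v refl = arc-irreflexive uv
      path : IsPath T (uv ∷ [])
      path = (u≢v ∷ []) ∷ [] ∷ []
      minimal : ∀ q → IsPath T q → 1 ≤ len T q
      minimal [] _ = contradiction refl u≢v
      minimal (_ ∷ _) _ = s≤s z≤n
      through : ∀ q → IsShortest T q → ArcOn T u v q
      through [] _ = contradiction refl u≢v
      through (e ∷ []) _ = here e []
      through (_ ∷ _ ∷ _) (_ , q-min) = contradiction (q-min (uv ∷ []) path) λ { (s≤s ()) }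

module _ {n : ℕ} {T : Tournament n} {M : Subset n} (mag : IsMAG T M) where

  open Walks T

  record Monitored (a b : Fin n) : Set where
    field
      {source target} : Fin n
      target∈M : target ∈ M
      before : Walk T source a
      ab : Arc T a b
      after : Walk T b target
      shortest : IsShortest T (before ++ ab ∷ after)
      through : ∀ (q : Walk T source target) → IsShortest T q → ArcOn T a b q

  fromGeodesics : ∀ {a b x y} → y ∈ M → OnAllShortest T x y a b → Monitored a b
  fromGeodesics y∈M ((p , p-short) , through) with A , e , B , refl ← arcOn-split (through p p-short) =
    record { target∈M = y∈M ; before = A ; ab = e ; after = B ; shortest = p-short ; through = through }

  monitored : ∀ {a b} → Arc T a b → Monitored a b
  monitored {a} {b} ab with mag a b ab
  ... | _ , _ , _ , y∈M , _ , inj₁ x⇝y = fromGeodesics y∈M x⇝y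
  ... | _ , _ , x∈M , _ , _ , inj₂ y⇝x = fromGeodesics x∈M y⇝x

  module _ {u v : Fin n} (u∉M : u ∉ M) (v∉M : v ∉ M) where

    Candidate : Fin n → Set
    Candidate w = Arc T v w × Arc T w u × (∀ {z} → z ≢ v → Arc T u z → Arc T w z)

    first-candidate : Arc T u v → ∃ Candidate
    first-candidate uv = continue target∈M before after shortest through
      where
        open Monitored (monitored uv)
        continue : ∀ {x y} → y ∈ M → (A : Walk T x u) (B : Walk T v y) →
          IsShortest T (A ++ ab ∷ B) → (∀ (q : Walk T x y) → IsShortest T q → ArcOn T u v q) →
          ∃ Candidate
        continue y∈M _ [] _ _ = contradiction y∈M v∉M
        continue _ A (_∷_ {y = b} vb C) short through = b , vb , bu , dominates
          where
            bu : Arc T b u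
            bu = shortest⇒back-arc A (ab ∷ vb ∷ []) C short (s≤s (s≤s z≤n))
            dominates : ∀ {z} → z ≢ v → Arc T u z → Arc T b z
            dominates {z} z≢v uz = ¬reverse⇒arc b≢z ¬zb
              where
                b≢z : b ≢ z
                b≢z refl = arc-asymmetric uz bu
                ¬zb : ¬ Arc T z b
                ¬zb zb = z≢v (sym (geodesic-middle-unique A ab vb C short through uz zb))

    Successor : Fin n → Set
    Successor w = ∃ λ c → Candidate c × Arc T c w × (∀ {z} → Arc T w z → Arc T c z)

    next-candidate : ∀ {w} → Candidate w → Successor w
    next-candidate {w} (_ , wu , dominates) = continue target∈M before after shortest
      where
        open Monitored (monitored wu)
        continue : ∀ {x y} → y ∈ M → (A : Walk T x w) (B : Walk T u y) →
          IsShortest T (A ++ ab ∷ B) → Successor w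
        continue y∈M _ [] _ = contradiction y∈M u∉M
        continue y∈M A (_∷_ {y = s} us B) short with s ≟ v
        ... | no s≢v = contradiction (dominates s≢v us)
                         (arc-asymmetric (shortest⇒back-arc A (ab ∷ us ∷ []) B short (s≤s (s≤s z≤n))))
        ... | yes refl with B
        ...   | [] = contradiction y∈M v∉M
        ...   | _∷_ {y = c} vc C =
          c , (vc , c-dominates wu , λ z≢v uz → c-dominates (dominates z≢v uz)) , cw , c-dominates
          where
            cw : Arc T c w
            cw = shortest⇒back-arc A (ab ∷ us ∷ vc ∷ []) C short (s≤s (s≤s z≤n))
            c-dominates : ∀ {z} → Arc T w z → Arc T c z
            c-dominates = shortest⇒out-dominated A (ab ∷ us ∷ vc ∷ []) C short (s≤s (s≤s (s≤s z≤n)))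

  no-arc-outside : ∀ {u v} → u ∉ M → v ∉ M → ¬ Arc T u v
  no-arc-outside u∉M v∉M uv =
    no-dominating-chain (Arc T) arc-irreflexive (first-candidate u∉M v∉M uv) (next-candidate u∉M v∉M)

one-non-member : ∀ {k} (M : Subset k) → ∣ M ∣ < k → ∃ λ u → u ∉ M
one-non-member (outside ∷ M) _ = zero , λ ()
one-non-member (inside ∷ M) (s≤s |M|<k) =
  let u , u∉M = one-non-member M |M|<k in suc u , u∉M ∘ drop-there

two-non-members : ∀ {k} (M : Subset (suc k)) → ∣ M ∣ < k → ∃₂ λ u v → u ≢ v × u ∉ M × v ∉ M
two-non-members (outside ∷ M) |M|<k =
  let v , v∉M = one-non-member M |M|<k in zero , suc v , (λ ()) , (λ ()) , v∉M ∘ drop-there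
two-non-members (inside ∷ M) (s≤s |M|<k) =
  let u , v , u≢v , u∉M , v∉M = two-non-members M |M|<k
  in suc u , suc v , u≢v ∘ suc-injective , u∉M ∘ drop-there , v∉M ∘ drop-there

mag-size-bound : ∀ {n} {T : Tournament n} {M : Subset n} → IsMAG T M → n ∸ 1 ≤ ∣ M ∣
mag-size-bound {zero} _ = z≤n
mag-size-bound {suc n} {T} {M} mag with n ≤? ∣ M ∣
... | yes n≤|M| = n≤|M|
... | no n≰|M| =
  let u , v , u≢v , u∉M , v∉M = two-non-members M (≰⇒> n≰|M|)
  in ⊥-elim ([ no-arc-outside mag u∉M v∉M , no-arc-outside mag v∉M u∉M ]′ (Walks.arc-total T u≢v))

descending : ∀ {m} → Fin m → Fin m → Bool
descending zero _ = false
descending (suc i) zero = true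
descending (suc i) (suc j) = descending i j

transitive : ∀ m → Tournament m
transitive m = record { arc = descending ; noLoop = irreflexive ; oneWay = one-way }
  where
    irreflexive : ∀ {m} (i : Fin m) → descending i i ≡ false
    irreflexive zero = refl
    irreflexive (suc i) = irreflexive i
    one-way : ∀ {m} (i j : Fin m) → i ≢ j →
      (descending i j ≡ true × descending j i ≡ false) ⊎ (descending i j ≡ false × descending j i ≡ true)
    one-way zero zero i≢j = contradiction refl i≢j
    one-way zero (suc j) _ = inj₂ (refl , refl)
    one-way (suc i) zero _ = inj₁ (refl , refl)
    one-way (suc i) (suc j) i≢j = one-way i j (i≢j ∘ cong suc)

-- Vertices 0 and 1 are new; vertex i + 2 is vertex i of T.
coneArc : ∀ {m} → Tournament m → Fin (2 + m) → Fin (2 + m) → Bool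
coneArc T zero (suc zero) = true
coneArc T (suc zero) (suc (suc _)) = true
coneArc T (suc (suc _)) zero = true
coneArc T (suc (suc i)) (suc (suc j)) = arc T i j
coneArc T _ _ = false

cone : ∀ {m} → Tournament m → Tournament (2 + m)
cone T = record { arc = coneArc T ; noLoop = irreflexive ; oneWay = one-way }
  where
    irreflexive : ∀ i → coneArc T i i ≡ false
    irreflexive zero = refl
    irreflexive (suc zero) = refl
    irreflexive (suc (suc i)) = noLoop T i
    one-way : ∀ i j → i ≢ j →
      (coneArc T i j ≡ true × coneArc T j i ≡ false) ⊎ (coneArc T i j ≡ false × coneArc T j i ≡ true)
    one-way zero zero i≢j = contradiction refl i≢j
    one-way zero (suc zero) _ = inj₁ (refl , refl)
    one-way zero (suc (suc _)) _ = inj₂ (refl , refl)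
    one-way (suc zero) zero _ = inj₂ (refl , refl)
    one-way (suc zero) (suc zero) i≢j = contradiction refl i≢j
    one-way (suc zero) (suc (suc _)) _ = inj₁ (refl , refl)
    one-way (suc (suc _)) zero _ = inj₁ (refl , refl)
    one-way (suc (suc _)) (suc zero) _ = inj₂ (refl , refl)
    one-way (suc (suc i)) (suc (suc j)) i≢j = oneWay T i j (i≢j ∘ λ { refl → refl })

cone-geodesics : ∀ {m} (T : Tournament m) (i : Fin m) →
  OnAllShortest (cone T) (suc (suc i)) (suc zero) (suc (suc i)) zero ×
  OnAllShortest (cone T) (suc (suc i)) (suc zero) zero (suc zero)
cone-geodesics T i = (geodesic , proj₁ ∘₂ through) , (geodesic , proj₂ ∘₂ through)
  where
    via-zero : Walk (cone T) (suc (suc i)) (suc zero)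
    via-zero = _∷_ {y = zero} refl (refl ∷ [])
    path : IsPath (cone T) via-zero
    path = ((λ ()) ∷ (λ ()) ∷ []) ∷ ((λ ()) ∷ []) ∷ [] ∷ []
    minimal : ∀ q → IsPath (cone T) q → 2 ≤ len (cone T) q
    minimal (() ∷ [])
    minimal (_ ∷ _ ∷ _) _ = s≤s (s≤s z≤n)
    geodesic : Σ (Walk (cone T) (suc (suc i)) (suc zero)) (IsShortest (cone T))
    geodesic = via-zero , path , minimal
    through : ∀ p → IsShortest (cone T) p →
      ArcOn (cone T) (suc (suc i)) zero p × ArcOn (cone T) zero (suc zero) p
    through (() ∷ [])
    through (_∷_ {y = zero} e (e′ ∷ [])) _ = here e _ , there e (here e′ [])
    through (_∷_ {y = suc zero} () _) _
    through (_∷_ {y = suc (suc _)} _ (() ∷ [])) _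
    through (_ ∷ _ ∷ _ ∷ _) (_ , p-min) = contradiction (p-min via-zero path) λ { (s≤s (s≤s ())) }

cone-mag : ∀ {m} (T : Tournament (suc m)) → IsMAG (cone T) (outside ∷ ⊤)
cone-mag T zero (suc zero) _ =
  suc (suc zero) , suc zero , there ∈⊤ , there ∈⊤ , (λ ()) , inj₁ (proj₂ (cone-geodesics T zero))
cone-mag T (suc (suc i)) zero _ =
  suc (suc i) , suc zero , there ∈⊤ , there ∈⊤ , (λ ()) , inj₁ (proj₁ (cone-geodesics T i))
cone-mag T (suc a) (suc b) ab =
  suc a , suc b , there ∈⊤ , there ∈⊤ , (λ { refl → Walks.arc-irreflexive (cone T) {suc a} ab }) ,
  inj₁ (Walks.arc-onAllShortest (cone T) ab)

theorem7 : ∀ (n : ℕ) → 3 ≤ n → MagMinusKIs n (n ∸ 1)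
theorem7 (suc (suc (suc m))) (s≤s (s≤s (s≤s _))) =
  (cone (transitive (suc m)) , outside ∷ ⊤ , cone-mag (transitive (suc m)) , ∣⊤∣≡n (2 + m)) ,
  λ _ _ → mag-size-bound
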